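{- If $S$ is a numerical semigroup, then $\mathrm{C}(S)=\mu(\gamma,S)$.
   Context: A numerical semigroup is a subset $S\subseteq\mathbb{N}$ containing $0$, closed under addition, with finite complement in $\mathbb{N}$; $\mathrm{F}(S)=\max(\mathbb{Z}\setminus S)$, $\mathrm{m}(S)=\min(S\setminus\{0\})$. For $S\ne\mathbb{N}$, $\gamma(S)=\{x\in\mathbb{N}\setminus S\mid \lfloor \mathrm{F}(S)/\mathrm{m}(S)\rfloor\,\mathrm{m}(S)\le x\le\mathrm{F}(S)\}$ (a nonempty set). Define $S_0=S$ and $S_{n+1}=S_n\cup\gamma(S_n)$ if $S_n\neq\mathbb{N}$, $S_{n+1}=\mathbb{N}$ otherwise; $\mu(\gamma,S)$ is the least $n$ with $S_n=\mathbb{N}$. An ideal of a numerical semigroup $\Delta$ is a nonempty $I\subseteq\Delta$ with $I+\Delta\subseteq I$; $\mathcal{J}(\Delta)$ is the set of numerical semigroups $U$ with $U\setminus\{0\}$ an ideal of $\Delta$; $\mathcal{J}(\mathscr{F})=\bigcup_{\Delta\in\mathscr{F}}\mathcal{J}(\Delta)$; $\mathcal{J}^0(\mathbb{N})=\{\mathbb{N}\}$, $\mathcal{J}^{k+1}(\mathbb{N})=\mathcal{J}(\mathcal{J}^k(\mathbb{N}))$; the complexity is $\mathrm{C}(S)=\min\{k\in\mathbb{N}\mid S\in\mathcal{J}^k(\mathbb{N})\}$. -}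

module Defs where

open import Data.Nat.Base using (ℕ; zero; suc; _+_; _*_; _≤_; _<_; _/_; NonZero; >-nonZero)
open import Data.Bool.Base using (Bool; true)
open import Data.Product using (Σ; ∃; ∃-syntax; _×_; proj₁)
open import Data.Sum.Base using (_⊎_)
open import Relation.Nullary using (¬_)
open import Relation.Binary.PropositionalEquality using (_≡_; _≢_)
open import Function.Bundles using (_⇔_)

Subset : Set
Subset = ℕ → Bool

_∈_ : ℕ → Subset → Set
x ∈ S = S x ≡ true

_∉_ : ℕ → Subset → Set
x ∉ S = ¬ (x ∈ S)

Full : Subset → Set
Full S = ∀ x → x ∈ S

IsNumericalSemigroup : Subset → Set
IsNumericalSemigroup S =
  (0 ∈ S) × (∀ x y → x ∈ S → y ∈ S → (x + y) ∈ S) × (∃[ N ] (∀ x → N ≤ x → x ∈ S))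

-- F(S) = f  (for S ≠ ℕ, F(S) = max (ℤ \ S) is a natural number)
IsFrobenius : Subset → ℕ → Set
IsFrobenius S f = (f ∉ S) × (∀ x → f < x → x ∈ S)

IsMultiplicity : Subset → ℕ → Set
IsMultiplicity S m = (0 < m) × (m ∈ S) × (∀ x → 0 < x → x < m → x ∉ S)

-- x ∈ γ(S), given F = F(S) and m = m(S)
InGamma : (S : Subset) (F m : ℕ) → 0 < m → ℕ → Set
InGamma S F m 0<m x = (x ∉ S) × ((_/_ F m {{>-nonZero 0<m}}) * m ≤ x) × (x ≤ F)

GammaStep : Subset → Subset → Set
GammaStep S T =
  (Full S × Full T)
  ⊎ ((¬ Full S) × ∃[ F ] ∃[ m ] (IsFrobenius S F × Σ (IsMultiplicity S m) λ mult →
       ∀ x → (x ∈ T) ⇔ ((x ∈ S) ⊎ InGamma S F m (proj₁ mult) x)))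

IsGammaSeq : Subset → (ℕ → Subset) → Set
IsGammaSeq S seq = (∀ x → seq 0 x ≡ S x) × (∀ k → GammaStep (seq k) (seq (suc k)))

IsMu : Subset → ℕ → Set
IsMu S n = ∃[ seq ] (IsGammaSeq S seq × Full (seq n) × (∀ k → k < n → ¬ Full (seq k)))

IsIdeal : Subset → (ℕ → Set) → Set
IsIdeal Δ I = (∃[ x ] I x) × (∀ x → I x → x ∈ Δ) × (∀ i d → I i → d ∈ Δ → I (i + d))

NonZeroPart : Subset → ℕ → Set
NonZeroPart U x = (x ∈ U) × (x ≢ 0)

data InJ : ℕ → Subset → Set where
  base : ∀ {U} → Full U → InJ 0 U
  step : ∀ {k Δ U} → InJ k Δ → IsNumericalSemigroup U → IsIdeal Δ (NonZeroPart U) → InJ (suc k) U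

IsComplexity : Subset → ℕ → Set
IsComplexity S k = InJ k S × (∀ j → j < k → ¬ InJ j S)

{-# OPTIONS --safe #-}
-- Call r(ℕ) = 0 and r(S) = ⌊F(S)/m(S)⌋ + 1 otherwise the rank of S. With q = ⌊F/m⌋, one γ-step replaces S
-- by T = S ∪ [qm, ∞): this T is a numerical semigroup containing S \ {0} as an ideal, and
-- r(T) = r(S) − 1. Iterating gives both a chain ℕ ∈ 𝒥(…) ∋ … ∋ S of length r(S) and μ(γ,S) = r(S).
-- Conversely, if S \ {0} is an ideal of Δ, then m(S) ∈ Δ while F(S) − m(S) ∉ Δ (it would
-- otherwise put F(S) in S), so m(Δ) ≤ m(S), F(Δ) ≥ F(S) − m(S) and r(Δ) ≥ r(S) − 1.
-- Hence any S ∈ 𝒥ᵏ(ℕ) has r(S) ≤ k, and C(S) = r(S) = μ(γ,S).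
module Submission where

open import Defs
open import Data.Bool.Base using (true; false; _∨_)
open import Data.Bool.Properties using (T-≡) renaming (_≟_ to _≟ᵇ_)
open import Data.Nat.Base using (ℕ; zero; suc; _+_; _*_; _∸_; _≤_; _<_; _≤ᵇ_; z≤n; s≤s; _/_; NonZero)
open import Data.Nat.Properties
open import Data.Nat.DivMod using (m≡m%n+[m/n]*n; m%n<n; m<n⇒m/n≡0; m/n≡1+[m∸n]/n; /-mono-≤; m<n*o⇒m/o<n)
open import Data.Product using (∃-syntax; _×_; _,_; proj₁; proj₂)
open import Data.Sum.Base using (_⊎_; inj₁; inj₂; [_,_])
open import Relation.Nullary using (¬_; Dec; yes; no; contradiction)
open import Relation.Binary.PropositionalEquality using (_≗_; refl; sym; trans; subst)
open import Function.Bundles using (_⇔_; mk⇔; Equivalence)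
import Function.Properties.Equivalence as ⇔

_∈?_ : (x : ℕ) (S : Subset) → Dec (x ∈ S)
x ∈? S = S x ≟ᵇ true

frobenius⇒¬full : ∀ {S F} → IsFrobenius S F → ¬ Full S
frobenius⇒¬full (F∉S , _) full = F∉S (full _)

∉⇒≤frobenius : ∀ {S F x} → IsFrobenius S F → x ∉ S → x ≤ F
∉⇒≤frobenius (_ , above) x∉S = ≮⇒≥ (λ F<x → x∉S (above _ F<x))

multiplicity≤ : ∀ {S m x} → IsMultiplicity S m → x ∈ S → 0 < x → m ≤ x
multiplicity≤ (_ , _ , below) x∈S 0<x = ≮⇒≥ (λ x<m → below _ 0<x x<m x∈S)

full⇒numerical : ∀ {S} → Full S → IsNumericalSemigroup S
full⇒numerical full = full 0 , (λ x y _ _ → full (x + y)) , 0 , λ x _ → full x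

full-or-frobenius : ∀ {S} N → (∀ x → N ≤ x → x ∈ S) → Full S ⊎ ∃[ F ] IsFrobenius S F
full-or-frobenius zero ≥N⇒∈ = inj₁ (λ x → ≥N⇒∈ x z≤n)
full-or-frobenius {S} (suc N) >N⇒∈ with N ∈? S
... | no  N∉S = inj₂ (N , N∉S , >N⇒∈)
... | yes N∈S = full-or-frobenius N ≥N⇒∈
  where
  ≥N⇒∈ : ∀ x → N ≤ x → x ∈ S
  ≥N⇒∈ x N≤x with m≤n⇒m<n∨m≡n N≤x
  ... | inj₁ N<x  = >N⇒∈ x N<x
  ... | inj₂ refl = N∈S

no-positive-element≤-or-multiplicity : ∀ S k →
  (∀ x → 0 < x → x ≤ k → x ∉ S) ⊎ ∃[ m ] IsMultiplicity S (suc m)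
no-positive-element≤-or-multiplicity S zero = inj₁ (λ { _ (s≤s _) () })
no-positive-element≤-or-multiplicity S (suc k) with no-positive-element≤-or-multiplicity S k
... | inj₂ multiplicity = inj₂ multiplicity
... | inj₁ none≤k with suc k ∈? S
...   | yes k+1∈S = inj₂ (k , s≤s z≤n , k+1∈S , λ x 0<x x<k+1 → none≤k x 0<x (≤-pred x<k+1))
...   | no  k+1∉S = inj₁ none≤k+1
  where
  none≤k+1 : ∀ x → 0 < x → x ≤ suc k → x ∉ S
  none≤k+1 x 0<x x≤k+1 with m≤n⇒m<n∨m≡n x≤k+1
  ... | inj₁ x<k+1 = none≤k x 0<x (≤-pred x<k+1)
  ... | inj₂ refl  = k+1∉S

multiplicity-exists : ∀ {S} → IsNumericalSemigroup S → ∃[ m ] IsMultiplicity S (suc m)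
multiplicity-exists {S} (_ , _ , N , ≥N⇒∈) with no-positive-element≤-or-multiplicity S (suc N)
... | inj₂ multiplicity = multiplicity
... | inj₁ none = contradiction (≥N⇒∈ (suc N) (n≤1+n N)) (none (suc N) (s≤s z≤n) ≤-refl)

data Rank (S : Subset) : ℕ → Set where
  full-rank : Full S → Rank S 0
  gap-rank  : ∀ {F m} → IsFrobenius S F → IsMultiplicity S (suc m) → Rank S (suc (F / suc m))

rank-exists : ∀ {S} → IsNumericalSemigroup S → ∃[ r ] Rank S r
rank-exists ns@(_ , _ , N , ≥N⇒∈) with full-or-frobenius N ≥N⇒∈ | multiplicity-exists ns
... | inj₁ full        | _          = 0 , full-rank full
... | inj₂ (_ , frob) | (_ , mult) = _ , gap-rank frob mult

∸-ideal-element-∉ : ∀ {Δ U i x} → IsIdeal Δ (NonZeroPart U) →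
  NonZeroPart U i → x ∉ U → i ≤ x → (x ∸ i) ∉ Δ
∸-ideal-element-∉ {U = U} (_ , _ , closed) i∈I x∉U i≤x x∸i∈Δ =
  x∉U (subst (_∈ U) (m+[n∸m]≡n i≤x) (proj₁ (closed _ _ i∈I x∸i∈Δ)))

ideal⇒rank≤1+rank : ∀ {Δ U r s} → IsIdeal Δ (NonZeroPart U) → Rank U r → Rank Δ s → r ≤ suc s
ideal⇒rank≤1+rank I (full-rank _) _ = z≤n
ideal⇒rank≤1+rank {Δ} {U} I (gap-rank {F} {m} frob mult) rankΔ with F <? suc m
... | yes F<M rewrite m<n⇒m/n≡0 F<M = s≤s z≤n
... | no  F≮M rewrite m/n≡1+[m∸n]/n (≮⇒≥ F≮M) = s≤s (quotient< rankΔ)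
  where
  M∈I : NonZeroPart U (suc m)
  M∈I = proj₁ (proj₂ mult) , λ ()
  F∸M∉Δ : (F ∸ suc m) ∉ Δ
  F∸M∉Δ = ∸-ideal-element-∉ I M∈I (proj₁ frob) (≮⇒≥ F≮M)
  quotient< : ∀ {s} → Rank Δ s → (F ∸ suc m) / suc m < s
  quotient< (full-rank full) = contradiction (full _) F∸M∉Δ
  quotient< (gap-rank frobΔ multΔ) = s≤s (/-mono-≤
    (∉⇒≤frobenius frobΔ F∸M∉Δ)
    (multiplicity≤ multΔ (proj₁ (proj₂ I) _ M∈I) (s≤s z≤n)))

m<n+[m/n]*n : ∀ m n .{{_ : NonZero n}} → m < n + m / n * n
m<n+[m/n]*n m n = subst (_< n + m / n * n) (sym (m≡m%n+[m/n]*n m n)) (+-monoˡ-< (m / n * n) (m%n<n m n))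

_∪≥_ : Subset → ℕ → Subset
(S ∪≥ c) x = S x ∨ (c ≤ᵇ x)

∈-∪≥ : ∀ S c x → x ∈ (S ∪≥ c) ⇔ (x ∈ S ⊎ c ≤ x)
∈-∪≥ S c x with S x
... | true  = mk⇔ (λ _ → inj₁ refl) (λ _ → refl)
... | false = mk⇔ (λ c≤ᵇx → inj₂ (≤ᵇ⇒≤ c x (Equivalence.from T-≡ c≤ᵇx)))
                  [ (λ ()) , (λ c≤x → Equivalence.to T-≡ (≤⇒≤ᵇ c≤x)) ]

module ∪≥-Membership (S : Subset) (c : ℕ) where

  ∈S⇒∈∪≥ : ∀ {x} → x ∈ S → x ∈ (S ∪≥ c)
  ∈S⇒∈∪≥ x∈S = Equivalence.from (∈-∪≥ S c _) (inj₁ x∈S)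

  ≥⇒∈∪≥ : ∀ {x} → c ≤ x → x ∈ (S ∪≥ c)
  ≥⇒∈∪≥ c≤x = Equivalence.from (∈-∪≥ S c _) (inj₂ c≤x)

  ∈∪≥⇒ : ∀ {x} → x ∈ (S ∪≥ c) → x ∈ S ⊎ c ≤ x
  ∈∪≥⇒ = Equivalence.to (∈-∪≥ S c _)

module _ {S : Subset} (c : ℕ) where
  open ∪≥-Membership S c

  ∪≥-numerical : IsNumericalSemigroup S → IsNumericalSemigroup (S ∪≥ c)
  ∪≥-numerical (0∈S , closed , N , ≥N⇒∈) =
    ∈S⇒∈∪≥ 0∈S , closed′ , N , λ x N≤x → ∈S⇒∈∪≥ (≥N⇒∈ x N≤x)
    where
    closed′ : ∀ x y → x ∈ (S ∪≥ c) → y ∈ (S ∪≥ c) → (x + y) ∈ (S ∪≥ c)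
    closed′ x y x∈ y∈ with ∈∪≥⇒ x∈ | ∈∪≥⇒ y∈
    ... | inj₁ x∈S | inj₁ y∈S = ∈S⇒∈∪≥ (closed x y x∈S y∈S)
    ... | inj₂ c≤x | _        = ≥⇒∈∪≥ (≤-trans c≤x (m≤m+n x y))
    ... | _        | inj₂ c≤y = ≥⇒∈∪≥ (≤-trans c≤y (m≤n+m y x))

  ∪≥-ideal : ∀ {F m} → IsNumericalSemigroup S → IsFrobenius S F → IsMultiplicity S m →
    F < m + c → IsIdeal (S ∪≥ c) (NonZeroPart S)
  ∪≥-ideal (_ , closed , _) (_ , above) mult@(0<m , m∈S , _) F<m+c =
    (_ , m∈S , n>0⇒n≢0 0<m) , (λ x x∈I → ∈S⇒∈∪≥ (proj₁ x∈I)) , closed′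
    where
    closed′ : ∀ i d → NonZeroPart S i → d ∈ (S ∪≥ c) → NonZeroPart S (i + d)
    closed′ i d (i∈S , i≢0) d∈ = i+d∈S (∈∪≥⇒ d∈) , λ i+d≡0 → i≢0 (m+n≡0⇒m≡0 i i+d≡0)
      where
      i+d∈S : d ∈ S ⊎ c ≤ d → (i + d) ∈ S
      i+d∈S (inj₁ d∈S) = closed i d i∈S d∈S
      i+d∈S (inj₂ c≤d) = above _ (<-≤-trans F<m+c
        (+-mono-≤ (multiplicity≤ mult i∈S (n≢0⇒n>0 i≢0)) c≤d))

γ-step : ∀ {S F m} → IsFrobenius S F → (mult : IsMultiplicity S (suc m)) →
  GammaStep S (S ∪≥ (F / suc m * suc m))
γ-step {S} {F} {m} frob mult =
  inj₂ (frobenius⇒¬full frob , F , suc m , frob , mult , λ x → mk⇔ (to x) (from x))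
  where
  c = F / suc m * suc m
  open ∪≥-Membership S c
  to : ∀ x → x ∈ (S ∪≥ c) → x ∈ S ⊎ InGamma S F (suc m) (proj₁ mult) x
  to x x∈ with x ∈? S | ∈∪≥⇒ x∈
  ... | yes x∈S | _        = inj₁ x∈S
  ... | no  x∉S | inj₁ x∈S = contradiction x∈S x∉S
  ... | no  x∉S | inj₂ c≤x = inj₂ (x∉S , c≤x , ∉⇒≤frobenius frob x∉S)
  from : ∀ x → x ∈ S ⊎ InGamma S F (suc m) (proj₁ mult) x → x ∈ (S ∪≥ c)
  from x (inj₁ x∈S)           = ∈S⇒∈∪≥ x∈S
  from x (inj₂ (_ , c≤x , _)) = ≥⇒∈∪≥ c≤x

∪≥-rank≤ : ∀ {S m r} → IsMultiplicity S (suc m) → ∀ q → Rank (S ∪≥ (q * suc m)) r → r ≤ q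
∪≥-rank≤ mult q (full-rank _) = z≤n
∪≥-rank≤ {S} mult zero (gap-rank frob _) = contradiction (∪≥-Membership.≥⇒∈∪≥ S 0 z≤n) (proj₁ frob)
∪≥-rank≤ {S} {m} mult q@(suc k) (gap-rank frob multT) =
  m<n*o⇒m/o<n (<-≤-trans F<qM (*-monoʳ-≤ q (M≤ (proj₁ multT) (∈∪≥⇒ (proj₁ (proj₂ multT))))))
  where
  open ∪≥-Membership S (q * suc m)
  F<qM = ≰⇒> (λ qM≤F → proj₁ frob (≥⇒∈∪≥ qM≤F))
  M≤ : ∀ {x} → 0 < x → x ∈ S ⊎ q * suc m ≤ x → suc m ≤ x
  M≤ 0<x (inj₁ x∈S)  = multiplicity≤ mult x∈S 0<x
  M≤ _   (inj₂ qM≤x) = ≤-trans (m≤m+n (suc m) (k * suc m)) qM≤x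

∪≥-rank : ∀ {S F m} → IsNumericalSemigroup S → IsFrobenius S F → IsMultiplicity S (suc m) →
  Rank (S ∪≥ (F / suc m * suc m)) (F / suc m)
∪≥-rank {S} {F} {m} ns frob mult with rank-exists (∪≥-numerical (F / suc m * suc m) ns)
... | r , rankT = subst (Rank _) (≤-antisym (∪≥-rank≤ mult q rankT) q≤r) rankT
  where
  q = F / suc m
  q≤r : q ≤ r
  q≤r = ≤-pred (ideal⇒rank≤1+rank (∪≥-ideal (q * suc m) ns frob mult (m<n+[m/n]*n F (suc m)))
                                  (gap-rank frob mult) rankT)

rank⇒InJ : ∀ {S} n → IsNumericalSemigroup S → Rank S n → InJ n S
rank⇒InJ zero    _  (full-rank full) = base full
rank⇒InJ (suc n) ns (gap-rank {F} {m} frob mult) =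
  step (rank⇒InJ n (∪≥-numerical c ns) (∪≥-rank ns frob mult)) ns
       (∪≥-ideal c ns frob mult (m<n+[m/n]*n F (suc m)))
  where c = F / suc m * suc m

InJ⇒numerical : ∀ {k Δ} → InJ k Δ → IsNumericalSemigroup Δ
InJ⇒numerical (base full)  = full⇒numerical full
InJ⇒numerical (step _ ns _) = ns

InJ⇒rank≤ : ∀ {j S n} → InJ j S → Rank S n → n ≤ j
InJ⇒rank≤ (base _)    (full-rank _)     = z≤n
InJ⇒rank≤ (base full) (gap-rank frob _) = contradiction full (frobenius⇒¬full frob)
InJ⇒rank≤ (step J _ I) rankS with rank-exists (InJ⇒numerical J)
... | _ , rankΔ = ≤-trans (ideal⇒rank≤1+rank I rankS rankΔ) (s≤s (InJ⇒rank≤ J rankΔ))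

GammaStep-resp-≗ : ∀ {S T T′} → T′ ≗ T → GammaStep S T → GammaStep S T′
GammaStep-resp-≗ T′≗T (inj₁ (fullS , fullT)) = inj₁ (fullS , λ x → trans (T′≗T x) (fullT x))
GammaStep-resp-≗ T′≗T (inj₂ (¬fullS , F , m , frob , mult , ∈T⇔)) =
  inj₂ (¬fullS , F , m , frob , mult , λ x →
    ⇔.trans (mk⇔ (trans (sym (T′≗T x))) (trans (T′≗T x))) (∈T⇔ x))

full⇒μ≡0 : ∀ {S} → Full S → IsMu S 0
full⇒μ≡0 {S} full = (λ _ → S) , ((λ _ → refl) , λ _ → inj₁ (full , full)) , full , λ _ ()

μ-suc : ∀ {S T n} → ¬ Full S → GammaStep S T → IsMu T n → IsMu S (suc n)
μ-suc {S} {n = n} ¬fullS S→T (seq , (seq₀≗T , steps) , full-seqₙ , ¬full-before) =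
  seq′ , ((λ _ → refl) , steps′) , full-seqₙ , ¬full-before′
  where
  seq′ : ℕ → Subset
  seq′ zero    = S
  seq′ (suc k) = seq k
  steps′ : ∀ k → GammaStep (seq′ k) (seq′ (suc k))
  steps′ zero    = GammaStep-resp-≗ seq₀≗T S→T
  steps′ (suc k) = steps k
  ¬full-before′ : ∀ k → k < suc n → ¬ Full (seq′ k)
  ¬full-before′ zero    _         = ¬fullS
  ¬full-before′ (suc k) (s≤s k<n) = ¬full-before k k<n

rank⇒μ : ∀ {S} n → IsNumericalSemigroup S → Rank S n → IsMu S n
rank⇒μ zero    _  (full-rank full) = full⇒μ≡0 full
rank⇒μ (suc n) ns (gap-rank {F} {m} frob mult) =
  μ-suc (frobenius⇒¬full frob) (γ-step frob mult)
        (rank⇒μ n (∪≥-numerical (F / suc m * suc m) ns) (∪≥-rank ns frob mult))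

corollary25 : (S : Subset) → IsNumericalSemigroup S → ∃[ k ] (IsComplexity S k × IsMu S k)
corollary25 S ns with rank-exists ns
... | r , rankS =
  r , (rank⇒InJ r ns rankS , λ j j<r S∈𝒥ʲ → <⇒≱ j<r (InJ⇒rank≤ S∈𝒥ʲ rankS)) , rank⇒μ r ns rankS
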